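{- Let $V$ be a finite set and let $\mathbf D=\{D_i\}_{i\in I}$ be a friendly family of designs built on $V$. Suppose that no two designs of $\mathbf D$ share a block and that the collection of all blocks of all designs in $\mathbf D$ is exactly the power set $\mathcal P(V)$. Then there exists a map $\alpha:\mathcal P(V)\to\mathbf D$ preserving the partial order, i.e. such that for all $X,Y\subseteq V$ with $X\subsetneq Y$ one has $\alpha(X)<\alpha(Y)$.
   Context: A block design with parameters $(v,b,r,k,\lambda)$ built on a finite set $V$ ($|V|=v$) is a list of $b$ blocks, each a $k$-subset of $V$, such that every element lies in exactly $r$ blocks and every pair of distinct elements lies in exactly $\lambda$ blocks; designs are simple. In families of designs, the empty set and the full set $V$ are regarded as degenerate designs (with single block $\emptyset$, resp. $V$) which may belong to the family. For a design $D$ with blocks $B_1,\dots,B_b$ of size $k$ and $M\subseteq V$, $\varphi(D,M)=(z_0,\dots,z_k)$ where $z_j$ is the number of $s$ with $|M\cap B_s|=j$. Two designs $D_1,D_2$ on $V$ are friends if $\varphi(D_1,D_2^i)$ is independent of the block $D_2^i$ of $D_2$ and $\varphi(D_2,D_1^j)$ is independent of the block $D_1^j$ of $D_1$; the common value is written $\varphi(D_1,D_2)$. A family of designs on $V$ is friendly if any two of its designs are friends. For friends $D,\overline D$ with block sizes $k<\overline k$ and $\varphi(D,\overline D)=(z_0,\dots,z_k)$, one writes $D<\overline D$ if $z_k>0$. The power set $\mathcal P(V)$ is ordered by inclusion. -}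

module Defs where

open import Data.Nat using (ℕ; _<_; _≟_)
open import Data.Fin using (Fin)
open import Data.Fin.Subset using (Subset; _∈_; _∩_; ∣_∣)
open import Data.Fin.Subset.Properties using (_∈?_)
open import Data.List using (List; _∷_; length; filter)
open import Data.List.Relation.Unary.All using (All)
open import Data.List.Relation.Unary.Unique.Propositional using (Unique)
import Data.List.Membership.Propositional as LM
open import Data.Product using (_×_; Σ; ∃)
open import Relation.Nullary using (¬_)
open import Relation.Nullary.Decidable using (_×-dec_)
open import Relation.Binary.PropositionalEquality using (_≡_; _≢_)

deg : ∀ {n} → Fin n → List (Subset n) → ℕ
deg x bs = length (filter (x ∈?_) bs)

deg₂ : ∀ {n} → Fin n → Fin n → List (Subset n) → ℕ
deg₂ x y bs = length (filter (λ B → (x ∈? B) ×-dec (y ∈? B)) bs)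

-- A (simple) block design with parameters (v,b,r,k,λ) on V = Fin n,
-- v = n, b = length blocks.  The blocks form a nonempty list (b ≥ 1),
-- so the degenerate designs [∅] and [V] are included.
record Design (n : ℕ) : Set where
  field
    firstBlock : Subset n
    otherBlocks : List (Subset n)
    k r λ′ : ℕ
  blocks : List (Subset n)
  blocks = firstBlock ∷ otherBlocks
  field
    simple : Unique blocks
    uniform : All (λ B → ∣ B ∣ ≡ k) blocks
    regular : ∀ (x : Fin n) → deg x blocks ≡ r
    balanced : ∀ (x y : Fin n) → x ≢ y → deg₂ x y blocks ≡ λ′

open Design public

-- φ(D,M) as a function of j : z_j = #{ blocks B of D : |M ∩ B| = j }
φ : ∀ {n} → Design n → Subset n → ℕ → ℕ
φ D M j = length (filter (λ B → ∣ M ∩ B ∣ ≟ j) (blocks D))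

Indep : ∀ {n} → Design n → Design n → Set
Indep D E = ∀ M M′ → M LM.∈ blocks E → M′ LM.∈ blocks E → ∀ j → φ D M j ≡ φ D M′ j

Friends : ∀ {n} → Design n → Design n → Set
Friends D E = Indep D E × Indep E D

-- the common value φ(D,E), computed at the (any) block of E
φ′ : ∀ {n} → Design n → Design n → ℕ → ℕ
φ′ D E j = φ D (firstBlock E) j

_≺_ : ∀ {n} → Design n → Design n → Set
D ≺ E = Friends D E × k D < k E × 0 < φ′ D E (k D)

Friendly : ∀ {n} {I : Set} → (I → Design n) → Set
Friendly {I = I} D = ∀ (i j : I) → i ≢ j → Friends (D i) (D j)

NoSharedBlock : ∀ {n} {I : Set} → (I → Design n) → Set
NoSharedBlock {n} {I} D = ∀ (i j : I) → i ≢ j → ∀ (X : Subset n) →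
  X LM.∈ blocks (D i) → ¬ (X LM.∈ blocks (D j))

CoversPowerSet : ∀ {n} {I : Set} → (I → Design n) → Set
CoversPowerSet {n} {I} D = ∀ (X : Subset n) → ∃ λ (i : I) → X LM.∈ blocks (D i)

module Submission where

-- Send every subset X ⊆ V to a design α(X) having X as a block
-- (it exists because the blocks of the family cover the power set).  If
-- X ⊂ Y are blocks of D and E respectively, then:
--   * k_D = |X| < |Y| = k_E, so D and E are different designs of the family
--     and hence friends;
--   * the block X of D meets the block Y of E in |Y ∩ X| = |X| = k_D points,
--     so the coordinate z_{k_D} of φ(D,Y) is positive; by friendship φ(D,Y)
--     does not depend on the block Y of E, so z_{k_D} of φ(D,E) is positive.
-- Hence D ≺ E.

open import Defs
open import Data.Nat using (ℕ; _<_; _≟_)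
open import Data.Nat.Properties using (<-irrefl; ≤-antisym)
open import Data.Fin.Subset using (Subset; _⊂_; _⊆_; _∩_; ∣_∣)
open import Data.Fin.Subset.Properties using (p⊂q⇒∣p∣<∣q∣; p⊆q⇒∣p∣≤∣q∣; ∣p∩q∣≤∣q∣; x∈p∩q⁺)
open import Data.List.Relation.Unary.All using (lookup)
open import Data.List.Relation.Unary.Any using (here)
open import Data.List.Membership.Propositional using (_∈_)
open import Data.List.Membership.Propositional.Properties using (∈-filter⁺; ∈-length)
open import Data.Product using (Σ; _,_; proj₁; proj₂)
open import Relation.Binary.PropositionalEquality using (_≡_; refl; sym; trans; subst; subst₂)
open import Relation.Nullary using (¬_)

∣∩-superset∣ : ∀ {n} (X Y : Subset n) → X ⊆ Y → ∣ Y ∩ X ∣ ≡ ∣ X ∣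
∣∩-superset∣ X Y X⊆Y =
  ≤-antisym (∣p∩q∣≤∣q∣ Y X) (p⊆q⇒∣p∣≤∣q∣ (λ x∈X → x∈p∩q⁺ (X⊆Y x∈X , x∈X)))

block-size : ∀ {n} (D : Design n) {B : Subset n} → B ∈ blocks D → ∣ B ∣ ≡ k D
block-size D = lookup (uniform D)

φ-positive : ∀ {n} (D : Design n) (M : Subset n) {B : Subset n} {j : ℕ} →
  B ∈ blocks D → ∣ M ∩ B ∣ ≡ j → 0 < φ D M j
φ-positive D M {j = j} B∈D MB≡j =
  ∈-length (∈-filter⁺ (λ B → ∣ M ∩ B ∣ ≟ j) B∈D MB≡j)

φ′-positive : ∀ {n} (D E : Design n) → Indep D E → {M : Subset n} {j : ℕ} →
  M ∈ blocks E → 0 < φ D M j → 0 < φ′ D E j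
φ′-positive D E indep {M} {j} M∈E pos =
  subst (0 <_) (sym (indep (firstBlock E) M (here refl) M∈E j)) pos

≺-of-nested-blocks : ∀ {n} (D E : Design n) → Friends D E → {X Y : Subset n} →
  X ∈ blocks D → Y ∈ blocks E → X ⊂ Y → D ≺ E
≺-of-nested-blocks D E friends@(indep , _) {X} {Y} X∈D Y∈E X⊂Y =
  friends , k-increases , φ′-positive D E indep Y∈E meets-in-k
  where
  k-increases : k D < k E
  k-increases = subst₂ _<_ (block-size D X∈D) (block-size E Y∈E) (p⊂q⇒∣p∣<∣q∣ X⊂Y)
  meets-in-k : 0 < φ D Y (k D)
  meets-in-k = φ-positive D Y X∈D (trans (∣∩-superset∣ X Y (proj₁ X⊂Y)) (block-size D X∈D))

different-sizes⇒different-designs : ∀ {n} {I : Set} (D : I → Design n) {i j : I}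
  {X Y : Subset n} → X ∈ blocks (D i) → Y ∈ blocks (D j) → X ⊂ Y → ¬ (i ≡ j)
different-sizes⇒different-designs D {i} X∈Di Y∈Dj X⊂Y refl =
  <-irrefl (trans (block-size (D i) X∈Di) (sym (block-size (D i) Y∈Dj))) (p⊂q⇒∣p∣<∣q∣ X⊂Y)

proposition3 : (n : ℕ) (I : Set) (D : I → Design n) → Friendly D → NoSharedBlock D → CoversPowerSet D
    → Σ (Subset n → I) (λ α → ∀ (X Y : Subset n) → X ⊂ Y → D (α X) ≺ D (α Y))
proposition3 n I D friendly _ covers = α , α-monotone
  where
  α : Subset n → I
  α X = proj₁ (covers X)

  X∈α : ∀ X → X ∈ blocks (D (α X))
  X∈α X = proj₂ (covers X)

  α-monotone : ∀ (X Y : Subset n) → X ⊂ Y → D (α X) ≺ D (α Y)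
  α-monotone X Y X⊂Y = ≺-of-nested-blocks (D (α X)) (D (α Y)) friends (X∈α X) (X∈α Y) X⊂Y
    where
    friends : Friends (D (α X)) (D (α Y))
    friends = friendly (α X) (α Y)
      (different-sizes⇒different-designs D (X∈α X) (X∈α Y) X⊂Y)
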